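{- Let $M$ be a matroid on ground set $E$ and let $B_1,\dots,B_s$ be distinct bases of $M$ forming a partial shelling, i.e. $B_1<\dots<B_s$ is a shelling order of the simplicial complex $\langle B_1,\dots,B_s\rangle$. Suppose there is a total order $<$ on $E$ such that $\{B_1,\dots,B_s\}$ is an order ideal of the poset $\mathrm{Int}_<(M)$. Then the partial shelling is extendable: there is an ordering $B_{s+1},\dots,B_t$ of the remaining bases of $M$ such that $B_1<\dots<B_s<B_{s+1}<\dots<B_t$ is a shelling order of the independence complex $\mathcal{I}(M)$.
   Context: A shelling order of a pure simplicial complex is an order $F_1<\dots<F_k$ of its facets such that for $j\ge2$, $\langle F_1,\dots,F_{j-1}\rangle\cap\langle F_j\rangle$ is pure of dimension $\dim F_j-1$, where $\langle\mathcal{G}\rangle$ denotes the complex generated by $\mathcal{G}$. For a total order $<$ on $E$ and a basis $B$, the internally passive set $IP_<(B)$ is the set of $b\in B$ for which there exists $b'\notin B$ with $b'<b$ and $(B\setminus\{b\})\cup\{b'\}$ a basis. $\mathrm{Int}_<(M)$ is the poset on the set of bases of $M$ with $B\preceq B'$ iff $IP_<(B)\subseteq IP_<(B')$. An order ideal of a poset is a downward-closed subset. -}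

module Defs where

open import Data.Nat using (ℕ; _≤_; _∸_)
open import Data.Fin using (Fin)
open import Data.Fin.Subset using (Subset; _∈_; _∉_; _⊆_; _∪_; _-_; ⁅_⁆; ∣_∣)
open import Data.List using (List; []; _∷_; _++_)
import Data.List.Membership.Propositional as LM
open import Data.List.Relation.Unary.Unique.Propositional using (Unique)
open import Data.Product using (Σ; ∃; _×_; _,_)
open import Relation.Binary.PropositionalEquality using (_≡_; _≢_)
open import Relation.Binary.Core using (Rel)
open import Relation.Binary.Structures using (IsStrictTotalOrder)
open import Relation.Nullary using (¬_)
open import Relation.Unary using (Decidable)
open import Function.Bundles using (_⇔_)
open import Level using (0ℓ)

-- A matroid on the ground set E = Fin n, given by its set of bases
-- (a finite, hence decidable, nonempty family satisfying basis exchange).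
record Matroid (n : ℕ) : Set₁ where
  field
    IsBasis  : Subset n → Set
    basis?   : Decidable IsBasis
    nonempty : ∃ λ B → IsBasis B
    exchange : ∀ B₁ B₂ → IsBasis B₁ → IsBasis B₂ →
               ∀ x → x ∈ B₁ → x ∉ B₂ →
               ∃ λ y → y ∈ B₂ × y ∉ B₁ × IsBasis ((B₁ - x) ∪ ⁅ y ⁆)

module _ {n : ℕ} where

  InComplex : List (Subset n) → Subset n → Set
  InComplex Fs G = ∃ λ F → F LM.∈ Fs × G ⊆ F

  PureOfCard : (Subset n → Set) → ℕ → Set
  PureOfCard Δ k = (∀ G → Δ G → ∣ G ∣ ≤ k)
                 × (∀ G → Δ G → ∃ λ H → Δ H × G ⊆ H × ∣ H ∣ ≡ k)

  -- F₁ < … < F_k is a shelling order: for every j ≥ 2,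
  -- ⟨F₁,…,F_{j-1}⟩ ∩ ⟨F_j⟩ is pure of dimension dim F_j - 1
  -- (i.e. of cardinality ∣F_j∣ - 1).
  IsShellingOrder : List (Subset n) → Set
  IsShellingOrder Fs =
    ∀ (pre : List (Subset n)) (F : Subset n) (post : List (Subset n)) →
    Fs ≡ pre ++ (F ∷ post) → pre ≢ [] →
    PureOfCard (λ G → InComplex pre G × G ⊆ F) (∣ F ∣ ∸ 1)

  module _ (M : Matroid n) (_<_ : Rel (Fin n) 0ℓ) where
    open Matroid M

    IP : Subset n → Fin n → Set
    IP B b = b ∈ B × ∃ λ b′ → b′ ∉ B × b′ < b × IsBasis ((B - b) ∪ ⁅ b′ ⁆)

    _⪯Int_ : Subset n → Subset n → Set
    B ⪯Int B′ = ∀ b → IP B b → IP B′ b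

    IsOrderIdealInt : List (Subset n) → Set
    IsOrderIdealInt Bs = ∀ B B′ → IsBasis B → IsBasis B′ →
                         B ⪯Int B′ → B′ LM.∈ Bs → B LM.∈ Bs

-- We append the remaining
-- bases in order of increasing ∣IP_<(B)∣ and show that every appended basis
-- F satisfies the shelling condition.
module Submission where

module ExtendableShelling where

  open import Data.Bool using (true)
  import Data.Bool.Properties as Bool
  open import Data.Empty using (⊥-elim)
  open import Data.Fin using (Fin; zero; suc)
  open import Data.Fin.Properties using (any?) renaming (_≟_ to _≟ᶠ_)
  open import Data.Fin.Subset
    using (Subset; inside; outside; _─_; _-_; _∪_; ⁅_⁆; ∣_∣; _∈_; _∉_; _⊆_)
  open import Data.Fin.Subset.Properties
    using (_∈?_; ⊆-antisym; x∈⁅x⁆; x∈⁅y⁆⇒x≡y; p─q⊆p; x∈p∪q⁻; x∈p∪q⁺; p─⊥≡p;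
           x∈p∧x≢y⇒x∈p-y; x∈p∧x∉q⇒x∈p─q; x∈p⇒∣p-x∣<∣p∣; p⊂q⇒∣p∣<∣q∣; p⊆q⇒∣p∣≤∣q∣)
  open import Data.List using (List; []; _∷_; _++_; filter; allFin; map)
  import Data.List.Properties as List
  open import Data.List.Membership.Propositional using ()
    renaming (_∈_ to _∈ˡ_; _∉_ to _∉ˡ_)
  open import Data.List.Membership.Propositional.Properties
    using (∈-filter⁺; ∈-filter⁻; ∈-allFin; ∈-map⁺; ∈-map⁻; ∈-++⁺ˡ; ∈-++⁺ʳ; ∈-++⁻)
  open import Data.List.Relation.Binary.Permutation.Propositional using (↭-sym; ↭⇒↭ₛ)
  open import Data.List.Relation.Binary.Permutation.Propositional.Properties using (∈-resp-↭)
  open import Data.List.Relation.Unary.All using (All; []; _∷_)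
  import Data.List.Relation.Unary.All as All
  import Data.List.Relation.Unary.All.Properties as All
  open import Data.List.Relation.Unary.AllPairs using (AllPairs; []; _∷_)
  open import Data.List.Relation.Unary.Any using (here; there)
  open import Data.List.Relation.Unary.Linked.Properties using (Linked⇒AllPairs)
  open import Data.List.Relation.Unary.Unique.Propositional using (Unique)
  import Data.List.Relation.Unary.Unique.Propositional.Properties as Unique
  open import Data.Nat using (ℕ; zero; suc; _∸_; s≤s; z≤n)
  import Data.Nat as ℕ
  import Data.Nat.Properties as ℕₚ
  open import Data.Nat.Induction using (<-wellFounded)
  open import Data.Product using (∃; _×_; _,_; proj₁; proj₂)
  open import Data.Sum using (_⊎_; inj₁; inj₂)
  import Data.Sum as Sum
  open import Data.Vec using ([]; _∷_; here; there; tabulate)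
  open import Data.Vec.Properties
    using (≡-dec; ∷-injectiveʳ; lookup∘tabulate; lookup⇒[]=; []=⇒lookup)
  open import Function using (_∘_; id)
  open import Function.Bundles using (_⇔_; mk⇔)
  open import Induction.WellFounded using (Acc; acc)
  open import Level using (0ℓ)
  open import Relation.Binary.Bundles using (TotalOrder)
  import Relation.Binary.Construct.On as On
  open import Relation.Binary.Core using (Rel)
  open import Relation.Binary.Definitions using (DecidableEquality; tri<; tri≈; tri>)
  open import Relation.Binary.PropositionalEquality
    using (_≡_; _≢_; refl; sym; trans; cong; subst; setoid)
  open import Relation.Binary.Structures using (IsStrictTotalOrder)
  open import Relation.Nullary using (¬_; Dec; yes; no; does; proof)
  open import Relation.Nullary.Decidable using (_×-dec_; ¬?; dec-true)
  open import Relation.Nullary.Reflects using (Reflects; invert)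
  import Relation.Unary as U

  open import Defs

  x∈p─q⇒x∉q : ∀ {m} {x : Fin m} (p q : Subset m) → x ∈ p ─ q → x ∉ q
  x∈p─q⇒x∉q (_ ∷ p) (inside  ∷ q) () here
  x∈p─q⇒x∉q (_ ∷ p) (inside  ∷ q) (there x∈) (there x∈q) = x∈p─q⇒x∉q p q x∈ x∈q
  x∈p─q⇒x∉q (_ ∷ p) (outside ∷ q) (there x∈) (there x∈q) = x∈p─q⇒x∉q p q x∈ x∈q

  ∣p-x∣≡∣p∣∸1 : ∀ {m} {x : Fin m} {p : Subset m} → x ∈ p → ∣ p - x ∣ ≡ ∣ p ∣ ∸ 1
  ∣p-x∣≡∣p∣∸1 {x = zero}  {inside ∷ p} here = cong ∣_∣ (p─⊥≡p p)
  ∣p-x∣≡∣p∣∸1 {x = suc x} {inside ∷ p} (there x∈p) =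
    trans (cong suc (∣p-x∣≡∣p∣∸1 x∈p)) (ℕₚ.m+[n∸m]≡n 1≤∣p∣)
    where
    1≤∣p∣ : 1 ℕ.≤ ∣ p ∣
    1≤∣p∣ = ℕₚ.≤-trans (s≤s z≤n) (x∈p⇒∣p-x∣<∣p∣ x∈p)
  ∣p-x∣≡∣p∣∸1 {x = suc x} {outside ∷ p} (there x∈p) = ∣p-x∣≡∣p∣∸1 x∈p

  module _ {m : ℕ} where

    x∈p-y⇒x≢y : ∀ {p : Subset m} {x y} → x ∈ p - y → x ≢ y
    x∈p-y⇒x≢y {p} {y = y} x∈ refl = x∈p─q⇒x∉q p ⁅ y ⁆ x∈ (x∈⁅x⁆ y)

    ∈∧∉⇒≢ : ∀ {B : Subset m} {z x} → z ∈ B → x ∉ B → z ≢ x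
    ∈∧∉⇒≢ z∈B x∉B refl = x∉B z∈B

    infixl 6 _[_↦_]
    _[_↦_] : Subset m → Fin m → Fin m → Subset m
    B [ x ↦ y ] = (B - x) ∪ ⁅ y ⁆

    ∈-exch⁻ : ∀ {B x y z} → z ∈ B [ x ↦ y ] → (z ∈ B × z ≢ x) ⊎ z ≡ y
    ∈-exch⁻ {B} {x} {y} z∈ with x∈p∪q⁻ (B - x) ⁅ y ⁆ z∈
    ... | inj₁ z∈B-x = inj₁ (p─q⊆p B ⁅ x ⁆ z∈B-x , x∈p-y⇒x≢y z∈B-x)
    ... | inj₂ z∈⁅y⁆ = inj₂ (x∈⁅y⁆⇒x≡y y z∈⁅y⁆)

    ∈-exch-old : ∀ {B x y z} → z ∈ B → z ≢ x → z ∈ B [ x ↦ y ]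
    ∈-exch-old z∈B z≢x = x∈p∪q⁺ (inj₁ (x∈p∧x≢y⇒x∈p-y z∈B z≢x))

    ∈-exch-new : ∀ {B x y} → y ∈ B [ x ↦ y ]
    ∈-exch-new {y = y} = x∈p∪q⁺ (inj₂ (x∈⁅x⁆ y))

    ∉-exch⁻ : ∀ {B x y z} → z ∉ B [ x ↦ y ] → z ≢ x → z ∉ B
    ∉-exch⁻ z∉ z≢x z∈B = z∉ (∈-exch-old z∈B z≢x)

    ∣exch─∣< : ∀ {p q : Subset m} {z u} → z ∈ p → z ∉ q → u ∈ q →
               ∣ p [ z ↦ u ] ─ q ∣ ℕ.< ∣ p ─ q ∣
    ∣exch─∣< {p} {q} {z} {u} z∈p z∉q u∈q =
      p⊂q⇒∣p∣<∣q∣ (shrunk , z , x∈p∧x∉q⇒x∈p─q z∈p z∉q , z∉)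
      where
      shrunk : p [ z ↦ u ] ─ q ⊆ p ─ q
      shrunk w∈ with ∈-exch⁻ (p─q⊆p (p [ z ↦ u ]) q w∈)
      ... | inj₁ (w∈p , _) = x∈p∧x∉q⇒x∈p─q w∈p (x∈p─q⇒x∉q _ q w∈)
      ... | inj₂ refl = ⊥-elim (x∈p─q⇒x∉q _ q w∈ u∈q)
      z∉ : z ∉ p [ z ↦ u ] ─ q
      z∉ z∈ with ∈-exch⁻ (p─q⊆p (p [ z ↦ u ]) q z∈)
      ... | inj₁ (_ , z≢z) = z≢z refl
      ... | inj₂ refl = z∉q u∈q

    exch-twice : ∀ {F x} y z → x ∉ F → F [ y ↦ x ] [ x ↦ z ] ≡ F [ y ↦ z ]
    exch-twice {F} {x} y z x∉F = ⊆-antisym to from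
      where
      to : F [ y ↦ x ] [ x ↦ z ] ⊆ F [ y ↦ z ]
      to w∈ with ∈-exch⁻ w∈
      ... | inj₂ refl = ∈-exch-new
      ... | inj₁ (w∈′ , w≢x) with ∈-exch⁻ w∈′
      ...   | inj₂ w≡x = ⊥-elim (w≢x w≡x)
      ...   | inj₁ (w∈F , w≢y) = ∈-exch-old w∈F w≢y
      from : F [ y ↦ z ] ⊆ F [ y ↦ x ] [ x ↦ z ]
      from w∈ with ∈-exch⁻ w∈
      ... | inj₂ refl = ∈-exch-new
      ... | inj₁ (w∈F , w≢y) = ∈-exch-old (∈-exch-old w∈F w≢y) (∈∧∉⇒≢ w∈F x∉F)

    exch-return : ∀ {F x y c} → y ∈ F → c ∈ F → c ≢ y → x ∉ F →
                  F [ y ↦ x ] [ c ↦ y ] ≡ F [ c ↦ x ]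
    exch-return {F} {x} {y} {c} y∈F c∈F c≢y x∉F = ⊆-antisym to from
      where
      to : F [ y ↦ x ] [ c ↦ y ] ⊆ F [ c ↦ x ]
      to w∈ with ∈-exch⁻ w∈
      ... | inj₂ refl = ∈-exch-old y∈F (c≢y ∘ sym)
      ... | inj₁ (w∈′ , w≢c) with ∈-exch⁻ w∈′
      ...   | inj₂ refl = ∈-exch-new
      ...   | inj₁ (w∈F , _) = ∈-exch-old w∈F w≢c
      from : F [ c ↦ x ] ⊆ F [ y ↦ x ] [ c ↦ y ]
      from {w} w∈ with ∈-exch⁻ w∈
      ... | inj₂ refl = ∈-exch-old ∈-exch-new (∈∧∉⇒≢ c∈F x∉F ∘ sym)
      ... | inj₁ (w∈F , w≢c) with w ≟ᶠ y
      ...   | yes refl = ∈-exch-new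
      ...   | no w≢y = ∈-exch-old (∈-exch-old w∈F w≢y) w≢c

    module DoubleExchange {F : Subset m} {y x c c′ : Fin m}
      (y∈F : y ∈ F) (c∈F : c ∈ F) (y≢c : y ≢ c)
      (x∉F : x ∉ F) (c′∉F : c′ ∉ F) (x≢c′ : x ≢ c′) where

      D : Subset m
      D = F [ y ↦ x ] [ c ↦ c′ ]

      D-new : ∀ {w} → w ∈ D → w ∉ F → w ≡ x ⊎ w ≡ c′
      D-new w∈ w∉F with ∈-exch⁻ w∈
      ... | inj₂ w≡c′ = inj₂ w≡c′
      ... | inj₁ (w∈′ , _) with ∈-exch⁻ w∈′
      ...   | inj₂ w≡x = inj₁ w≡x
      ...   | inj₁ (w∈F , _) = ⊥-elim (w∉F w∈F)

      D-old : ∀ {w} → w ∈ F → w ∉ D → w ≡ y ⊎ w ≡ c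
      D-old {w} w∈F w∉D with w ≟ᶠ y | w ≟ᶠ c
      ... | yes w≡y | _ = inj₁ w≡y
      ... | no _ | yes w≡c = inj₂ w≡c
      ... | no w≢y | no w≢c = ⊥-elim (w∉D (∈-exch-old (∈-exch-old w∈F w≢y) w≢c))

      x∈D : x ∈ D
      x∈D = ∈-exch-old ∈-exch-new (∈∧∉⇒≢ c∈F x∉F ∘ sym)

      c∉D : c ∉ D
      c∉D c∈ with ∈-exch⁻ c∈
      ... | inj₁ (_ , c≢c) = c≢c refl
      ... | inj₂ refl = c′∉F c∈F

      undo-y : D [ x ↦ y ] ≡ F [ c ↦ c′ ]
      undo-y = ⊆-antisym to from
        where
        to : D [ x ↦ y ] ⊆ F [ c ↦ c′ ]
        to w∈ with ∈-exch⁻ w∈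
        ... | inj₂ refl = ∈-exch-old y∈F y≢c
        ... | inj₁ (w∈D , w≢x) with ∈-exch⁻ w∈D
        ...   | inj₂ refl = ∈-exch-new
        ...   | inj₁ (w∈′ , w≢c) with ∈-exch⁻ w∈′
        ...     | inj₂ w≡x = ⊥-elim (w≢x w≡x)
        ...     | inj₁ (w∈F , _) = ∈-exch-old w∈F w≢c
        from : F [ c ↦ c′ ] ⊆ D [ x ↦ y ]
        from {w} w∈ with ∈-exch⁻ w∈
        ... | inj₂ refl = ∈-exch-old ∈-exch-new (x≢c′ ∘ sym)
        ... | inj₁ (w∈F , w≢c) with w ≟ᶠ y
        ...   | yes refl = ∈-exch-new
        ...   | no w≢y = ∈-exch-old (∈-exch-old (∈-exch-old w∈F w≢y) w≢c) (∈∧∉⇒≢ w∈F x∉F)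

      undo-c : D [ x ↦ c ] ≡ F [ y ↦ c′ ]
      undo-c = ⊆-antisym to from
        where
        to : D [ x ↦ c ] ⊆ F [ y ↦ c′ ]
        to w∈ with ∈-exch⁻ w∈
        ... | inj₂ refl = ∈-exch-old c∈F (y≢c ∘ sym)
        ... | inj₁ (w∈D , w≢x) with ∈-exch⁻ w∈D
        ...   | inj₂ refl = ∈-exch-new
        ...   | inj₁ (w∈′ , _) with ∈-exch⁻ w∈′
        ...     | inj₂ w≡x = ⊥-elim (w≢x w≡x)
        ...     | inj₁ (w∈F , w≢y) = ∈-exch-old w∈F w≢y
        from : F [ y ↦ c′ ] ⊆ D [ x ↦ c ]
        from {w} w∈ with ∈-exch⁻ w∈
        ... | inj₂ refl = ∈-exch-old ∈-exch-new (x≢c′ ∘ sym)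
        ... | inj₁ (w∈F , w≢y) with w ≟ᶠ c
        ...   | yes refl = ∈-exch-new
        ...   | no w≢c = ∈-exch-old (∈-exch-old (∈-exch-old w∈F w≢y) w≢c) (∈∧∉⇒≢ w∈F x∉F)

  module Bases {n : ℕ} (M : Matroid n) where
    open Matroid M

    basis-⊆⇒≡ : ∀ {B F} → IsBasis B → IsBasis F → B ⊆ F → B ≡ F
    basis-⊆⇒≡ {B} {F} hB hF B⊆F = ⊆-antisym B⊆F F⊆B
      where
      F⊆B : F ⊆ B
      F⊆B {x} x∈F with x ∈? B
      ... | yes x∈B = x∈B
      ... | no x∉B with exchange F B hF hB x x∈F x∉B
      ...   | y , y∈B , y∉F , _ = ⊥-elim (y∉F (B⊆F y∈B))

    basis-≢⇒∃∉ : ∀ {B F} → IsBasis B → IsBasis F → B ≢ F → ∃ λ x → x ∈ B × x ∉ F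
    basis-≢⇒∃∉ {B} {F} hB hF B≢F with any? (λ x → (x ∈? B) ×-dec ¬? (x ∈? F))
    ... | yes found = found
    ... | no none = ⊥-elim (B≢F (basis-⊆⇒≡ hB hF B⊆F))
      where
      B⊆F : B ⊆ F
      B⊆F {x} x∈B with x ∈? F
      ... | yes x∈F = x∈F
      ... | no x∉F = ⊥-elim (none (x , x∈B , x∉F))

    exchange-among : ∀ {B₁ B₂ x a b} → IsBasis B₁ → IsBasis B₂ → x ∈ B₁ → x ∉ B₂ →
                     (∀ {w} → w ∈ B₂ → w ∉ B₁ → w ≡ a ⊎ w ≡ b) →
                     IsBasis (B₁ [ x ↦ a ]) ⊎ IsBasis (B₁ [ x ↦ b ])
    exchange-among {B₁} {B₂} {x} hB₁ hB₂ x∈B₁ x∉B₂ among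
      with exchange B₁ B₂ hB₁ hB₂ x x∈B₁ x∉B₂
    ... | w , w∈B₂ , w∉B₁ , hw with among w∈B₂ w∉B₁
    ...   | inj₁ refl = inj₁ hw
    ...   | inj₂ refl = inj₂ hw

    module _ {F : Subset n} {y x c c′ : Fin n}
      (y∈F : y ∈ F) (c∈F : c ∈ F) (y≢c : y ≢ c)
      (x∉F : x ∉ F) (c′∉F : c′ ∉ F) (x≢c′ : x ≢ c′) where
      open DoubleExchange y∈F c∈F y≢c x∉F c′∉F x≢c′

      double-exchange-c : IsBasis F → IsBasis D →
                          IsBasis (F [ c ↦ x ]) ⊎ IsBasis (F [ c ↦ c′ ])
      double-exchange-c hF hD = exchange-among hF hD c∈F c∉D D-new

      double-exchange-x : IsBasis F → IsBasis D →
                          IsBasis (F [ c ↦ c′ ]) ⊎ IsBasis (F [ y ↦ c′ ])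
      double-exchange-x hF hD =
        Sum.map (subst IsBasis undo-y) (subst IsBasis undo-c)
                (exchange-among hD hF x∈D x∉F D-old)

    symmetric-exchange : ∀ {B₁ B₂ y} → IsBasis B₁ → IsBasis B₂ → y ∈ B₂ → y ∉ B₁ →
      ∃ λ z → z ∈ B₁ × z ∉ B₂ × IsBasis (B₁ [ z ↦ y ]) × IsBasis (B₂ [ y ↦ z ])
    symmetric-exchange {B₁} {B₂} {y} hB₁ hB₂ y∈B₂ = go (<-wellFounded _) hB₁
      where
      Goal : Subset n → Set
      Goal B = ∃ λ z → z ∈ B × z ∉ B₂ × IsBasis (B [ z ↦ y ]) × IsBasis (B₂ [ y ↦ z ])

      -- Induction on ∣ B ─ B₂ ∣: exchange B towards B₂ until y is reached.
      go : ∀ {B} → Acc ℕ._<_ ∣ B ─ B₂ ∣ → IsBasis B → y ∉ B → Goal B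
      go {B} (acc rec) hB y∉B with exchange B₂ B hB₂ hB y y∈B₂ y∉B
      ... | z₀ , z₀∈B , z₀∉B₂ , hB₂′ with exchange B B₂ hB hB₂ z₀ z₀∈B z₀∉B₂
      ...   | u , u∈B₂ , u∉B , hB′ with u ≟ᶠ y
      ...     | yes refl = z₀ , z₀∈B , z₀∉B₂ , hB′ , hB₂′
      ...     | no u≢y = transfer (go (rec (∣exch─∣< z₀∈B z₀∉B₂ u∈B₂)) hB′ y∉B′)
        where
        y∉B′ : y ∉ B [ z₀ ↦ u ]
        y∉B′ y∈ with ∈-exch⁻ y∈
        ... | inj₁ (y∈B , _) = y∉B y∈B
        ... | inj₂ y≡u = u≢y (sym y≡u)
        transfer : Goal (B [ z₀ ↦ u ]) → Goal B
        transfer (z , z∈B′ , z∉B₂ , hz , hB₂″) with ∈-exch⁻ z∈B′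
        ... | inj₂ refl = ⊥-elim (z∉B₂ u∈B₂)
        ... | inj₁ (z∈B , z≢z₀) with double-exchange-x z₀∈B z∈B (z≢z₀ ∘ sym) u∉B y∉B u≢y hB hz
        ...   | inj₁ hBz = z , z∈B , z∉B₂ , hBz , hB₂″
        ...   | inj₂ hBz₀ = z₀ , z₀∈B , z₀∉B₂ , hBz₀ , hB₂′

  infix 4 _≟ˢ_
  _≟ˢ_ : ∀ {m} → DecidableEquality (Subset m)
  _≟ˢ_ = ≡-dec Bool._≟_

  module Ordered {n : ℕ} (M : Matroid n) (_<_ : Rel (Fin n) 0ℓ)
                 (sto : IsStrictTotalOrder _≡_ _<_) where
    open Matroid M
    open Bases M
    open IsStrictTotalOrder sto using (compare; irrefl; asym; _<?_)
      renaming (trans to <-trans)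

    open import Relation.Binary.Construct.StrictToNonStrict _≡_ _<_ as NonStrict
      using (_≤_)

    ≤-totalOrder : TotalOrder 0ℓ 0ℓ 0ℓ
    ≤-totalOrder = record { isTotalOrder = NonStrict.isTotalOrder sto }

    open import Data.List.Extrema ≤-totalOrder using (min; min≤xs; argmin-all)

    ≤-<-trans : ∀ {x y z} → x ≤ y → y < z → x < z
    ≤-<-trans (inj₁ x<y) y<z = <-trans x<y y<z
    ≤-<-trans (inj₂ refl) y<z = y<z

    ≤⇒≯ : ∀ {x y} → x ≤ y → ¬ y < x
    ≤⇒≯ (inj₁ x<y) = asym x<y
    ≤⇒≯ (inj₂ refl) = irrefl refl

    ≤∧≢⇒< : ∀ {x y} → x ≤ y → x ≢ y → x < y
    ≤∧≢⇒< (inj₁ x<y) _ = x<y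
    ≤∧≢⇒< (inj₂ x≡y) x≢y = ⊥-elim (x≢y x≡y)

    least : ∀ {P : Fin n → Set} → U.Decidable P → ∀ {e₀} → P e₀ →
            ∃ λ x → P x × (∀ {e} → P e → x ≤ e)
    least {P} P? {e₀} Pe₀ =
      min e₀ xs , argmin-all id Pe₀ (All.all-filter P? (allFin n)) ,
      λ Pe → All.lookup (min≤xs e₀ xs) (∈-filter⁺ P? (∈-allFin _) Pe)
      where
      xs : List (Fin n)
      xs = filter P? (allFin n)

    Passive : Subset n → Fin n → Set
    Passive = IP M _<_

    _⪯_ : Subset n → Subset n → Set
    _⪯_ = _⪯Int_ M _<_

    passive? : ∀ B b → Dec (Passive B b)
    passive? B b = (b ∈? B) ×-dec
      any? (λ b′ → ¬? (b′ ∈? B) ×-dec ((b′ <? b) ×-dec basis? (B [ b ↦ b′ ])))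

    infix 4 _≺_
    _≺_ : Subset n → Subset n → Set
    B ≺ F = B ⪯ F × ∃ λ b → Passive F b × ¬ Passive B b

    ≺-trans : ∀ {B F G} → B ≺ F → F ≺ G → B ≺ G
    ≺-trans (B⪯F , _) (F⪯G , b , b∈IP[G] , b∉IP[F]) =
      (λ c → F⪯G c ∘ B⪯F c) , b , b∈IP[G] , b∉IP[F] ∘ B⪯F b

    passiveSet : Subset n → Subset n
    passiveSet B = tabulate (does ∘ passive? B)

    ∣IP∣ : Subset n → ℕ
    ∣IP∣ B = ∣ passiveSet B ∣

    ∈-passiveSet⁺ : ∀ {B b} → Passive B b → b ∈ passiveSet B
    ∈-passiveSet⁺ {B} {b} pb =
      lookup⇒[]= b (passiveSet B) (trans (lookup∘tabulate _ b) (dec-true (passive? B b) pb))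

    ∈-passiveSet⁻ : ∀ {B b} → b ∈ passiveSet B → Passive B b
    ∈-passiveSet⁻ {B} {b} b∈ =
      invert (subst (Reflects (Passive B b)) does≡true (proof (passive? B b)))
      where
      does≡true : does (passive? B b) ≡ true
      does≡true = trans (sym (lookup∘tabulate _ b)) ([]=⇒lookup b∈)

    ∣IP∣-mono : ∀ {B F} → B ≺ F → ∣IP∣ B ℕ.< ∣IP∣ F
    ∣IP∣-mono (B⪯F , b , b∈IP[F] , b∉IP[B]) =
      p⊂q⇒∣p∣<∣q∣ ( ∈-passiveSet⁺ ∘ B⪯F _ ∘ ∈-passiveSet⁻
                  , b , ∈-passiveSet⁺ b∈IP[F] , b∉IP[B] ∘ ∈-passiveSet⁻ )

    -- If IP_<(B) ⊆ F for bases B, F, then every y ∈ F ∖ B is internally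
    -- passive in F (by symmetric exchange of y with some z ∈ B ∖ F).
    passive-outside : ∀ {B F y} → IsBasis B → IsBasis F →
                      (∀ b → Passive B b → b ∈ F) → y ∈ F → y ∉ B → Passive F y
    passive-outside {B} {F} {y} hB hF cover y∈F y∉B
      with symmetric-exchange hB hF y∈F y∉B
    ... | z , z∈B , z∉F , hB′ , hF′ with compare z y
    ...   | tri< z<y _ _ = y∈F , z , z∉F , z<y , hF′
    ...   | tri≈ _ refl _ = ⊥-elim (y∉B z∈B)
    ...   | tri> _ _ y<z = ⊥-elim (z∉F (cover z (z∈B , y , y∉B , y<z , hB′)))

    -- Lowering an internally passive y of F: exchanging y for the least x
    -- such that F [ y ↦ x ] is a basis keeps every other passive element
    -- passive, while y itself is not passive any more.
    module Lowering {F : Subset n} {y x : Fin n} (hF : IsBasis F)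
      (y∈F : y ∈ F) (x∉F : x ∉ F) (x<y : x < y) (hF′ : IsBasis (F [ y ↦ x ]))
      (x-least : ∀ {e} → e ∉ F → IsBasis (F [ y ↦ e ]) → x ≤ e) where

      F′ : Subset n
      F′ = F [ y ↦ x ]

      y-not-passive : ¬ Passive F′ y
      y-not-passive (y∈F′ , _) with ∈-exch⁻ y∈F′
      ... | inj₁ (_ , y≢y) = y≢y refl
      ... | inj₂ y≡x = irrefl (sym y≡x) x<y

      -- An element c ≢ y of F that is passive in F′ via c′ is passive in F:
      -- via x if c′ = y, otherwise via c′ or x by the double-exchange lemmas.
      old-passive : ∀ {c c′} → c ∈ F → c ≢ y → c′ ∉ F′ → c′ < c →
                    IsBasis (F′ [ c ↦ c′ ]) → Passive F c
      old-passive {c} {c′} c∈F c≢y c′∉F′ c′<c hD with c′ ≟ᶠ y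
      ... | yes refl = c∈F , x , x∉F , <-trans x<y c′<c ,
                       subst IsBasis (exch-return y∈F c∈F c≢y x∉F) hD
      ... | no c′≢y = choose (double-exchange-c y∈F c∈F (c≢y ∘ sym) x∉F c′∉F x≢c′ hF hD)
                             (double-exchange-x y∈F c∈F (c≢y ∘ sym) x∉F c′∉F x≢c′ hF hD)
        where
        c′∉F : c′ ∉ F
        c′∉F = ∉-exch⁻ c′∉F′ c′≢y
        x≢c′ : x ≢ c′
        x≢c′ refl = c′∉F′ ∈-exch-new
        choose : IsBasis (F [ c ↦ x ]) ⊎ IsBasis (F [ c ↦ c′ ]) →
                 IsBasis (F [ c ↦ c′ ]) ⊎ IsBasis (F [ y ↦ c′ ]) → Passive F c
        choose (inj₂ hc′) _ = c∈F , c′ , c′∉F , c′<c , hc′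
        choose (inj₁ _) (inj₁ hc′) = c∈F , c′ , c′∉F , c′<c , hc′
        choose (inj₁ hx) (inj₂ hy) =
          c∈F , x , x∉F , <-trans (≤∧≢⇒< (x-least c′∉F hy) x≢c′) c′<c , hx

      -- Passivity of the new element x in F′ would contradict the minimality of x.
      passive-preserved : F′ ⪯ F
      passive-preserved c (c∈F′ , c′ , c′∉F′ , c′<c , hD) with ∈-exch⁻ c∈F′
      ... | inj₁ (c∈F , c≢y) = old-passive c∈F c≢y c′∉F′ c′<c hD
      ... | inj₂ refl with c′ ≟ᶠ y
      ...   | yes refl = ⊥-elim (asym x<y c′<c)
      ...   | no c′≢y = ⊥-elim (≤⇒≯ (x-least c′∉F (subst IsBasis (exch-twice y c′ x∉F) hD)) c′<c)
        where
        c′∉F : c′ ∉ F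
        c′∉F = ∉-exch⁻ c′∉F′ c′≢y

      F′≺F : F′ ≺ F
      F′≺F = passive-preserved , y , (y∈F , x , x∉F , x<y , hF′) , y-not-passive

    lower : ∀ {F y} → IsBasis F → Passive F y →
            ∃ λ x → IsBasis (F [ y ↦ x ]) × F [ y ↦ x ] ≺ F
    lower {F} {y} hF (y∈F , b′ , b′∉F , b′<y , hb′)
      with least (λ e → ¬? (e ∈? F) ×-dec basis? (F [ y ↦ e ])) (b′∉F , hb′)
    ... | x , (x∉F , hx) , x-least = x , hx , F′≺F
      where
      open Lowering hF y∈F x∉F (≤-<-trans (x-least (b′∉F , hb′)) b′<y) hx
                    (λ e∉F he → x-least (e∉F , he))

    -- If every internally passive element of a basis B lies in another basis F,
    -- then B ≺ F.  Induction on ∣IP∣ F: lower F at an element of F ∖ B.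
    passive-cover⇒≺ : ∀ {B F} → IsBasis B → IsBasis F → F ≢ B →
                      (∀ b → Passive B b → b ∈ F) → B ≺ F
    passive-cover⇒≺ {B} hB = go (<-wellFounded _)
      where
      go : ∀ {F} → Acc ℕ._<_ (∣IP∣ F) → IsBasis F → F ≢ B →
           (∀ b → Passive B b → b ∈ F) → B ≺ F
      go {F} (acc rec) hF F≢B cover with basis-≢⇒∃∉ hF hB F≢B
      ... | y , y∈F , y∉B with lower hF (passive-outside hB hF cover y∈F y∉B)
      ...   | x , hF′ , F′≺F with F [ y ↦ x ] ≟ˢ B
      ...     | yes refl = F′≺F
      ...     | no F′≢B = ≺-trans (go (rec (∣IP∣-mono F′≺F)) hF′ F′≢B cover′) F′≺F
        where
        cover′ : ∀ b → Passive B b → b ∈ F [ y ↦ x ]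
        cover′ b pb = ∈-exch-old (cover b pb) (λ { refl → y∉B (proj₁ pb) })

    shelling-step : ∀ {F pre} → IsBasis F → All IsBasis pre → F ∉ˡ pre →
                    (∀ {G} → IsBasis G → G ≺ F → G ∈ˡ pre) →
                    (∀ {G} → G ∈ˡ pre → ¬ F ≺ G) →
                    PureOfCard (λ G → InComplex pre G × G ⊆ F) (∣ F ∣ ∸ 1)
    shelling-step {F} {pre} hF pre-bases F∉pre below not-above = bounded , extends
      where
      other-basis : ∀ {F′} → F′ ∈ˡ pre → IsBasis F′ × F′ ≢ F
      other-basis F′∈pre = All.lookup pre-bases F′∈pre , λ { refl → F∉pre F′∈pre }

      -- A face of F lying in another basis F′ misses some element of F.
      bounded : ∀ G → InComplex pre G × G ⊆ F → ∣ G ∣ ℕ.≤ ∣ F ∣ ∸ 1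
      bounded G ((F′ , F′∈pre , G⊆F′) , G⊆F)
        with basis-≢⇒∃∉ hF (proj₁ (other-basis F′∈pre)) (proj₂ (other-basis F′∈pre) ∘ sym)
      ... | x , x∈F , x∉F′ =
            ℕₚ.≤-trans (p⊆q⇒∣p∣≤∣q∣ G⊆F-x) (ℕₚ.≤-reflexive (∣p-x∣≡∣p∣∸1 x∈F))
        where
        G⊆F-x : G ⊆ F - x
        G⊆F-x z∈G = x∈p∧x≢y⇒x∈p-y (G⊆F z∈G) (λ { refl → x∉F′ (G⊆F′ z∈G) })

      -- A face G of F in ⟨pre⟩ misses some passive b of F (otherwise F ≺ F′ for
      -- the basis F′ ⊇ G in pre); then F - b ⊇ G lies in the lowered basis F [ b ↦ x ].
      extends : ∀ G → InComplex pre G × G ⊆ F →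
                ∃ λ H → (InComplex pre H × H ⊆ F) × G ⊆ H × ∣ H ∣ ≡ ∣ F ∣ ∸ 1
      extends G ((F′ , F′∈pre , G⊆F′) , G⊆F) with any? (λ b → passive? F b ×-dec ¬? (b ∈? G))
      ... | yes (b , b∈IP[F] , b∉G) with lower hF b∈IP[F]
      ...   | x , hF′ , F′≺F =
              F - b , ((F [ b ↦ x ] , below hF′ F′≺F , F-b⊆F′) , p─q⊆p F ⁅ b ⁆) ,
              G⊆F-b , ∣p-x∣≡∣p∣∸1 (proj₁ b∈IP[F])
        where
        F-b⊆F′ : F - b ⊆ F [ b ↦ x ]
        F-b⊆F′ z∈ = x∈p∪q⁺ (inj₁ z∈)
        G⊆F-b : G ⊆ F - b
        G⊆F-b z∈G = x∈p∧x≢y⇒x∈p-y (G⊆F z∈G) (λ { refl → b∉G z∈G })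
      extends G ((F′ , F′∈pre , G⊆F′) , G⊆F) | no all-in-G =
        ⊥-elim (not-above F′∈pre (passive-cover⇒≺ hF hF′ F′≢F cover))
        where
        hF′ : IsBasis F′
        hF′ = proj₁ (other-basis F′∈pre)
        F′≢F : F′ ≢ F
        F′≢F = proj₂ (other-basis F′∈pre)
        cover : ∀ b → Passive F b → b ∈ F′
        cover b pb with b ∈? G
        ... | yes b∈G = G⊆F′ b∈G
        ... | no b∉G = ⊥-elim (all-in-G (b , pb , b∉G))

  subsets : ∀ m → List (Subset m)
  subsets zero = [] ∷ []
  subsets (suc m) = map (inside ∷_) (subsets m) ++ map (outside ∷_) (subsets m)

  ∈-subsets : ∀ {m} (p : Subset m) → p ∈ˡ subsets m
  ∈-subsets [] = here refl
  ∈-subsets {suc m} (inside ∷ p) = ∈-++⁺ˡ (∈-map⁺ (inside ∷_) (∈-subsets p))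
  ∈-subsets {suc m} (outside ∷ p) =
    ∈-++⁺ʳ (map (inside ∷_) (subsets m)) (∈-map⁺ (outside ∷_) (∈-subsets p))

  subsets-unique : ∀ m → Unique (subsets m)
  subsets-unique zero = [] ∷ []
  subsets-unique (suc m) =
    Unique.++⁺ (Unique.map⁺ ∷-injectiveʳ (subsets-unique m))
               (Unique.map⁺ ∷-injectiveʳ (subsets-unique m)) disjoint
    where
    disjoint : ∀ {p} → ¬ (p ∈ˡ map (inside ∷_) (subsets m) × p ∈ˡ map (outside ∷_) (subsets m))
    disjoint (p∈in , p∈out) with ∈-map⁻ (inside ∷_) p∈in | ∈-map⁻ (outside ∷_) p∈out
    ... | _ , _ , refl | _ , _ , ()

  module _ {A : Set} where

    ++-split : ∀ (xs ys pre : List A) F post → xs ++ ys ≡ pre ++ F ∷ post →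
               (∃ λ post′ → xs ≡ pre ++ F ∷ post′) ⊎
               (∃ λ ys₁ → pre ≡ xs ++ ys₁ × ys ≡ ys₁ ++ F ∷ post)
    ++-split [] ys pre F post eq = inj₂ (pre , refl , eq)
    ++-split (x ∷ xs) ys [] F post refl = inj₁ (xs , refl)
    ++-split (x ∷ xs) ys (p ∷ pre) F post eq with List.∷-injective eq
    ... | refl , eq′ with ++-split xs ys pre F post eq′
    ...   | inj₁ (post′ , e) = inj₁ (post′ , cong (x ∷_) e)
    ...   | inj₂ (ys₁ , e₁ , e₂) = inj₂ (ys₁ , cong (x ∷_) e₁ , e₂)

    AllPairs-split : ∀ {R : A → A → Set} xs {F ys} → AllPairs R (xs ++ F ∷ ys) →
                     (∀ {G} → G ∈ˡ xs → R G F) × (∀ {G} → G ∈ˡ ys → R F G)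
    AllPairs-split [] (F-R ∷ _) = (λ ()) , All.lookup F-R
    AllPairs-split (x ∷ xs) (x-R ∷ rest) =
      (λ { (here refl) → All.lookup x-R (∈-++⁺ʳ xs (here refl))
         ; (there G∈xs) → proj₁ (AllPairs-split xs rest) G∈xs })
      , proj₂ (AllPairs-split xs rest)

  shelling-++ : ∀ {m} {Bs rest : List (Subset m)} → IsShellingOrder Bs →
    (∀ rest₁ F post → rest ≡ rest₁ ++ F ∷ post →
       PureOfCard (λ G → InComplex (Bs ++ rest₁) G × G ⊆ F) (∣ F ∣ ∸ 1)) →
    IsShellingOrder (Bs ++ rest)
  shelling-++ {Bs = Bs} {rest} shelling-Bs step pre F post eq pre≢[]
    with ++-split Bs rest pre F post eq
  ... | inj₁ (post′ , e) = shelling-Bs pre F post′ e pre≢[]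
  ... | inj₂ (rest₁ , refl , e) = step rest₁ F post e

  module Extension {n : ℕ} (M : Matroid n) (_<_ : Rel (Fin n) 0ℓ)
    (sto : IsStrictTotalOrder _≡_ _<_) (Bs : List (Subset n))
    (Bs-bases : All (Matroid.IsBasis M) Bs) (Bs-unique : Unique Bs)
    (ideal : IsOrderIdealInt M _<_ Bs) where
    open Matroid M
    open Ordered M _<_ sto
    open import Data.List.Sort (On.decTotalOrder ℕₚ.≤-decTotalOrder ∣IP∣)
      using (sort; sort-↭; sort-↗)
    open import Data.List.Membership.DecPropositional (_≟ˢ_ {n}) using ()
      renaming (_∈?_ to _∈ˡ?_)
    open import Data.List.Relation.Binary.Permutation.Setoid.Properties (setoid (Subset n))
      using (Unique-resp-↭)

    new? : ∀ B → Dec (IsBasis B × B ∉ˡ Bs)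
    new? B = basis? B ×-dec ¬? (B ∈ˡ? Bs)

    new-bases : List (Subset n)
    new-bases = filter new? (subsets n)

    rest : List (Subset n)
    rest = sort new-bases

    ∈-rest⁻ : ∀ {G} → G ∈ˡ rest → IsBasis G × G ∉ˡ Bs
    ∈-rest⁻ G∈ = proj₂ (∈-filter⁻ new? {xs = subsets n} (∈-resp-↭ (sort-↭ new-bases) G∈))

    ∈-rest⁺ : ∀ {G} → IsBasis G → G ∉ˡ Bs → G ∈ˡ rest
    ∈-rest⁺ hG G∉Bs =
      ∈-resp-↭ (↭-sym (sort-↭ new-bases)) (∈-filter⁺ new? (∈-subsets _) (hG , G∉Bs))

    rest-unique : Unique rest
    rest-unique = Unique-resp-↭ (↭⇒↭ₛ (↭-sym (sort-↭ new-bases)))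
                                (Unique.filter⁺ new? (subsets-unique n))

    rest-sorted : AllPairs (λ G H → ∣IP∣ G ℕ.≤ ∣IP∣ H) rest
    rest-sorted = Linked⇒AllPairs ℕₚ.≤-trans (sort-↗ new-bases)

    unique : Unique (Bs ++ rest)
    unique = Unique.++⁺ Bs-unique rest-unique
                        (λ (G∈Bs , G∈rest) → proj₂ (∈-rest⁻ G∈rest) G∈Bs)

    complete : ∀ B → IsBasis B ⇔ B ∈ˡ Bs ++ rest
    complete B = mk⇔ to from
      where
      to : IsBasis B → B ∈ˡ Bs ++ rest
      to hB with B ∈ˡ? Bs
      ... | yes B∈Bs = ∈-++⁺ˡ B∈Bs
      ... | no B∉Bs = ∈-++⁺ʳ Bs (∈-rest⁺ hB B∉Bs)
      from : B ∈ˡ Bs ++ rest → IsBasis B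
      from B∈ with ∈-++⁻ Bs B∈
      ... | inj₁ B∈Bs = All.lookup Bs-bases B∈Bs
      ... | inj₂ B∈rest = proj₁ (∈-rest⁻ B∈rest)

    rest-step : ∀ rest₁ F post → rest ≡ rest₁ ++ F ∷ post →
                PureOfCard (λ G → InComplex (Bs ++ rest₁) G × G ⊆ F) (∣ F ∣ ∸ 1)
    rest-step rest₁ F post eq = shelling-step hF pre-bases F∉pre below not-above
      where
      from-split : ∀ {G} → G ∈ˡ rest₁ ++ F ∷ post → G ∈ˡ rest
      from-split = subst (_ ∈ˡ_) (sym eq)
      F∈rest : F ∈ˡ rest
      F∈rest = from-split (∈-++⁺ʳ rest₁ (here refl))
      hF : IsBasis F
      hF = proj₁ (∈-rest⁻ F∈rest)
      sorted : (∀ {G} → G ∈ˡ rest₁ → ∣IP∣ G ℕ.≤ ∣IP∣ F) ×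
               (∀ {G} → G ∈ˡ post → ∣IP∣ F ℕ.≤ ∣IP∣ G)
      sorted = AllPairs-split rest₁ (subst (AllPairs _) eq rest-sorted)
      pre-bases : All IsBasis (Bs ++ rest₁)
      pre-bases = All.++⁺ Bs-bases
                          (All.tabulate (λ G∈ → proj₁ (∈-rest⁻ (from-split (∈-++⁺ˡ G∈)))))
      F∉pre : F ∉ˡ Bs ++ rest₁
      F∉pre F∈ with ∈-++⁻ Bs F∈
      ... | inj₁ F∈Bs = proj₂ (∈-rest⁻ F∈rest) F∈Bs
      ... | inj₂ F∈rest₁ = proj₁ (AllPairs-split rest₁ (subst Unique eq rest-unique)) F∈rest₁ refl
      -- Bases strictly below F have fewer passive elements, so come earlier.
      below : ∀ {G} → IsBasis G → G ≺ F → G ∈ˡ Bs ++ rest₁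
      below {G} hG G≺F with G ∈ˡ? Bs
      ... | yes G∈Bs = ∈-++⁺ˡ G∈Bs
      ... | no G∉Bs with ∈-++⁻ rest₁ (subst (G ∈ˡ_) eq (∈-rest⁺ hG G∉Bs))
      ...   | inj₁ G∈rest₁ = ∈-++⁺ʳ Bs G∈rest₁
      ...   | inj₂ (here refl) = ⊥-elim (ℕₚ.<-irrefl refl (∣IP∣-mono G≺F))
      ...   | inj₂ (there G∈post) = ⊥-elim (ℕₚ.<⇒≱ (∣IP∣-mono G≺F) (proj₂ sorted G∈post))
      -- Nothing before F lies strictly above it: Bs is an order ideal and rest is sorted.
      not-above : ∀ {G} → G ∈ˡ Bs ++ rest₁ → ¬ F ≺ G
      not-above G∈ F≺G with ∈-++⁻ Bs G∈
      ... | inj₁ G∈Bs =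
            proj₂ (∈-rest⁻ F∈rest) (ideal F _ hF (All.lookup Bs-bases G∈Bs) (proj₁ F≺G) G∈Bs)
      ... | inj₂ G∈rest₁ = ℕₚ.<⇒≱ (∣IP∣-mono F≺G) (proj₁ sorted G∈rest₁)

    shelling : IsShellingOrder Bs → IsShellingOrder (Bs ++ rest)
    shelling shelling-Bs = shelling-++ shelling-Bs rest-step

open import Defs
open import Data.Nat using (ℕ)
open import Data.Fin using (Fin)
open import Data.Fin.Subset using (Subset)
open import Data.List using (List; _++_)
open import Data.List.Membership.Propositional using (_∈_)
open import Data.List.Relation.Unary.All using (All)
open import Data.List.Relation.Unary.Unique.Propositional using (Unique)
open import Data.Product using (∃; _×_; _,_)
open import Relation.Binary.Core using (Rel)
open import Relation.Binary.PropositionalEquality using (_≡_)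
open import Relation.Binary.Structures using (IsStrictTotalOrder)
open import Function.Bundles using (_⇔_)
open import Level using (0ℓ)
open ExtendableShelling using (module Extension)

corollary5p3 : (n : ℕ) (M : Matroid n) (Bs : List (Subset n)) →
    All (Matroid.IsBasis M) Bs → Unique Bs → IsShellingOrder Bs →
    (_<_ : Rel (Fin n) 0ℓ) → IsStrictTotalOrder _≡_ _<_ →
    IsOrderIdealInt M _<_ Bs →
    ∃ λ (rest : List (Subset n)) →
      Unique (Bs ++ rest)
      × (∀ B → Matroid.IsBasis M B ⇔ B ∈ Bs ++ rest)
      × IsShellingOrder (Bs ++ rest)
corollary5p3 n M Bs Bs-bases Bs-unique shelling-Bs _<_ sto ideal =
  rest , unique , complete , shelling shelling-Bs
  where open Extension M _<_ sto Bs Bs-bases Bs-unique ideal
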